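{- Let $\nu$ be any partition, $0$ the empty partition, and let $k=\max\{i: \nu_i-(i-1)\ge 1\}$. Then $\rho(0,\nu)=(\nu_1,\nu_2-1,\dots,\nu_k-(k-1))$ and the conjugate of $\lambda(0,\nu)$ is $\lambda'(0,\nu)=(\nu'_1-1,\nu'_2-2,\dots,\nu'_k-k)$ (equalities of partitions up to trailing zeros).
   Context: Partitions are weakly decreasing sequences of nonnegative integers, identified up to trailing zeros; $\nu'$ is the conjugate partition. For partitions $\mu,\nu$ written as $n$-tuples ($n\ge$ the number of nonzero parts of each), the $*$-operation is $(\mu,\nu)^*=(\lambda(\mu,\nu),\rho(\mu,\nu))$ with $\lambda_k=\mu_k-k+\#\{j\in\{1,\dots,n\}: \nu_j-j\ge \mu_k-k\}$ and $\rho_j=\nu_j-j+1+\#\{k\in\{1,\dots,n\}:\mu_k-k>\nu_j-j\}$. -}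

module Defs where

open import Data.Nat using (ℕ; zero; suc; _≤_; _<_; _+_)
open import Data.Integer as ℤ using (ℤ; +_; _-_)
open import Data.Bool using (Bool; true; false; if_then_else_)
open import Data.List using (List; []; _∷_; map; length; applyUpTo)
open import Relation.Nullary using (does)
open import Data.Product using (_×_)
open import Data.Sum using (_⊎_)
open import Relation.Binary.PropositionalEquality using (_≡_)
open import Relation.Nullary using (¬_)

-- A partition is represented by a finite list of natural numbers (weakly
-- decreasing); partitions are identified up to trailing zeros.

-- 1-indexed entry with default 0 beyond the end (index 0 gives 0, unused).
entry : List ℕ → ℕ → ℕ
entry []       _             = 0
entry (x ∷ xs) zero          = 0
entry (x ∷ xs) (suc zero)    = x
entry (x ∷ xs) (suc (suc i)) = entry xs (suc i)

entryℤ : List ℤ → ℕ → ℤ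
entryℤ []       _             = + 0
entryℤ (x ∷ xs) zero          = + 0
entryℤ (x ∷ xs) (suc zero)    = x
entryℤ (x ∷ xs) (suc (suc i)) = entryℤ xs (suc i)

IsPartition : List ℕ → Set
IsPartition p = ∀ i → entry p (suc (suc i)) ≤ entry p (suc i)

PartsAtMost : ℕ → List ℕ → Set
PartsAtMost n p = ∀ i → n < i → entry p i ≡ 0

_≈_ : List ℤ → List ℤ → Set
a ≈ b = ∀ i → 1 ≤ i → entryℤ a i ≡ entryℤ b i

range : ℕ → List ℕ
range n = applyUpTo suc n

count : ℕ → (ℕ → Bool) → ℕ
count zero    P = 0
count (suc n) P = count n P + (if P (suc n) then 1 else 0)

-- the *-operation, components as n-tuples of integers
-- λ_k = μ_k - k + #{ j ≤ n : ν_j - j ≥ μ_k - k }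
lam : ℕ → List ℕ → List ℕ → List ℤ
lam n μ ν = map (λ k → (+ entry μ k - + k)
                        ℤ.+ + count n (λ j → does ((+ entry μ k - + k) ℤ.≤? (+ entry ν j - + j))))
                (range n)

rho : ℕ → List ℕ → List ℕ → List ℤ
rho n μ ν = map (λ j → (+ entry ν j - + j) ℤ.+ + 1
                        ℤ.+ + count n (λ k → does ((+ entry ν j - + j) ℤ.<? (+ entry μ k - + k))))
                (range n)

conj : List ℕ → List ℕ
conj ν = map (λ i → count (length ν) (λ j → does (i Data.Nat.≤? entry ν j))) (range (entry ν 1))
  where import Data.Nat

-- k is max { i ≥ 1 : ν_i - (i-1) ≥ 1 }, with k = 0 when this set is empty
IsMaxIndex : List ℕ → ℕ → Set
IsMaxIndex ν k =
  (k ≡ 0 ⊎ (1 ≤ k × + entry ν k - (+ k - + 1) ℤ.≥ + 1)) ×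
  (∀ i → 1 ≤ i → k < i → ¬ (+ entry ν i - (+ i - + 1) ℤ.≥ + 1))

rhoTarget : List ℕ → ℕ → List ℤ
rhoTarget ν k = map (λ i → + entry ν i - (+ i - + 1)) (range k)

lamConjTarget : List ℕ → ℕ → List ℤ
lamConjTarget ν k = map (λ i → + entry (conj ν) i - + i) (range k)

-- With μ = ∅ the counts defining ρ and λ become counts of natural numbers.
-- For ρ_j: if ν_j ≥ j no index m has −m > ν_j − j, so ρ_j = ν_j − j + 1; if
-- ν_j < j exactly j − 1 − ν_j of them do, so ρ_j = 0; and ν_j ≥ j holds
-- precisely for j ≤ k.  For λ_m = #{j : j ≤ ν_j + m} − m: the condition
-- j ≤ ν_j + m is downward closed in j, so i ≤ λ_m iff i ≤ ν_{i+m}.  Hence λ is a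
-- partition and λ'_i = #{m ≥ 1 : ν_{i+m} ≥ i}, which is ν'_i − i when ν_i ≥ i
-- (the first i parts are then all ≥ i) and 0 otherwise.

module Submission where

open import Defs
open import Data.Bool using (Bool; if_then_else_)
open import Data.Integer as ℤ using (ℤ; +_; +≤+)
import Data.Integer.Properties as ℤₚ
open import Data.Integer.Tactic.RingSolver using (solve-∀)
open import Data.List using (List; []; _∷_; map; applyUpTo; length)
open import Data.List.Properties using (map-∘)
open import Data.Nat
open import Data.Nat.Properties
open import Data.Product using (_×_; _,_; proj₂; ∃-syntax)
open import Data.Sum using (_⊎_; inj₁; inj₂)
open import Function.Bundles using (_⇔_; mk⇔; Equivalence)
open import Relation.Binary.PropositionalEquality
open import Relation.Nullary using (yes; no; does; ¬_; contradiction)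
open import Relation.Nullary.Decidable using (dec-true; dec-false; does-⇔)
open import Relation.Unary using (Decidable)

open Equivalence using (to; from)

private
  variable
    P Q : ℕ → Set

count-⇔ : ∀ n {P? : Decidable P} {Q? : Decidable Q} →
          (∀ j → 1 ≤ j → j ≤ n → P j ⇔ Q j) →
          count n (λ j → does (P? j)) ≡ count n (λ j → does (Q? j))
count-⇔ zero    P⇔Q = refl
count-⇔ (suc n) {P?} {Q?} P⇔Q =
  cong₂ (λ c b → c + (if b then 1 else 0))
        (count-⇔ n {P?} {Q?} (λ j 1≤j j≤n → P⇔Q j 1≤j (m≤n⇒m≤1+n j≤n)))
        (does-⇔ (P⇔Q (suc n) (s≤s z≤n) ≤-refl) (P? (suc n)) (Q? (suc n)))

count-all : ∀ n {P? : Decidable P} → (∀ j → 1 ≤ j → j ≤ n → P j) →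
            count n (λ j → does (P? j)) ≡ n
count-all zero    all = refl
count-all (suc n) {P?} all
  rewrite count-all n {P?} (λ j 1≤j j≤n → all j 1≤j (m≤n⇒m≤1+n j≤n))
        | dec-true (P? (suc n)) (all (suc n) (s≤s z≤n) ≤-refl) = +-comm n 1

count-none : ∀ n {P? : Decidable P} → (∀ j → 1 ≤ j → j ≤ n → ¬ P j) →
             count n (λ j → does (P? j)) ≡ 0
count-none zero    none = refl
count-none (suc n) {P?} none
  rewrite count-none n {P?} (λ j 1≤j j≤n → none j 1≤j (m≤n⇒m≤1+n j≤n))
        | dec-false (P? (suc n)) (none (suc n) (s≤s z≤n) ≤-refl) = refl

count-+ : ∀ a r (P : ℕ → Bool) → count (a + r) P ≡ count a P + count r (λ m → P (a + m))
count-+ a zero    P rewrite +-identityʳ a | +-identityʳ (count a P) = refl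
count-+ a (suc r) P rewrite +-suc a r | count-+ a r P =
  +-assoc (count a P) (count r (λ m → P (a + m))) _

count-pad : ∀ a r {P? : Decidable P} → (∀ j → a < j → ¬ P j) →
            count (a + r) (λ j → does (P? j)) ≡ count a (λ j → does (P? j))
count-pad a r {P?} none = begin
  count (a + r) F                ≡⟨ count-+ a r F ⟩
  count a F + count r (λ m → F (a + m))
    ≡⟨ cong (λ x → count a F + x)
            (count-none r {λ m → P? (a + m)} (λ m 1≤m _ → none (a + m) (m<m+n a 1≤m))) ⟩
  count a F + 0                  ≡⟨ +-identityʳ _ ⟩
  count a F                      ∎
  where
    open ≡-Reasoning
    F = λ j → does (P? j)

count-split : ∀ {a n} {P? : Decidable P} → a ≤ n → (∀ j → n < j → ¬ P j) →
              count n (λ j → does (P? j)) ≡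
              count a (λ j → does (P? j)) + count n (λ m → does (P? (a + m)))
count-split {a = a} {n} {P?} a≤n none = begin
  count n F                          ≡⟨ cong (λ x → count x F) (m+[n∸m]≡n a≤n) ⟨
  count (a + (n ∸ a)) F              ≡⟨ count-+ a (n ∸ a) F ⟩
  count a F + count (n ∸ a) G        ≡⟨ cong (λ x → count a F + x) shifted-tail ⟨
  count a F + count n G              ∎
  where
    open ≡-Reasoning
    F = λ j → does (P? j)
    G = λ m → does (P? (a + m))
    shifted-tail : count n G ≡ count (n ∸ a) G
    shifted-tail = trans (cong (λ x → count x G) (sym (m∸n+n≡m a≤n)))
                         (count-pad (n ∸ a) a {λ m → P? (a + m)} (λ m lt → none (a + m)
                           (subst (_< a + m) (m+[n∸m]≡n a≤n) (+-monoʳ-< a lt))))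

count-≤? : ∀ {c n} → c ≤ n → count n (λ m → does (m ≤? c)) ≡ c
count-≤? {c} {n} c≤n = begin
  count n F             ≡⟨ cong (λ x → count x F) (m+[n∸m]≡n c≤n) ⟨
  count (c + (n ∸ c)) F ≡⟨ count-pad c (n ∸ c) {_≤? c} (λ j c<j → <⇒≱ c<j) ⟩
  count c F             ≡⟨ count-all c {_≤? c} (λ j _ j≤c → j≤c) ⟩
  c                     ∎
  where
    open ≡-Reasoning
    F = λ m → does (m ≤? c)

downwardClosed-≤ : (∀ j → P (suc j) → P j) → ∀ {i j} → i ≤ j → P j → P i
downwardClosed-≤ {P = P} closed i≤j = go (≤⇒≤′ i≤j)
  where
    go : ∀ {i j} → i ≤′ j → P j → P i
    go ≤′-refl       p = p
    go (≤′-step i≤j) p = go i≤j (closed _ p)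

count-downwardClosed : ∀ n {P? : Decidable P} → (∀ j → P (suc j) → P j) → ∀ t →
                       (suc t ≤ count n (λ j → does (P? j))) ⇔ (suc t ≤ n × P (suc t))
count-downwardClosed zero    closed t = mk⇔ (λ ()) (λ { (() , _) })
count-downwardClosed {P = P} (suc n) {P?} closed t with P? (suc n)
... | yes p = mk⇔ (λ h → let h′ = subst (suc t ≤_) full h in h′ , downwardClosed-≤ {P = P} closed h′ p)
                  (λ (h , _) → subst (suc t ≤_) (sym full) h)
  where
    full : count n (λ j → does (P? j)) + 1 ≡ suc n
    full = trans (cong (_+ 1) (count-all n {P?} (λ j _ j≤n →
                   downwardClosed-≤ {P = P} closed (m≤n⇒m≤1+n j≤n) p)))
                 (+-comm n 1)
... | no ¬p = mk⇔ (λ h → let (h′ , q) = to ih (subst (suc t ≤_) (+-identityʳ _) h) in m≤n⇒m≤1+n h′ , q)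
                  (λ (h , q) → subst (suc t ≤_) (sym (+-identityʳ _)) (from ih (below h q)))
  where
    ih : (suc t ≤ count n (λ j → does (P? j))) ⇔ (suc t ≤ n × P (suc t))
    ih = count-downwardClosed n {P?} closed t
    below : suc t ≤ suc n → P (suc t) → suc t ≤ n × P (suc t)
    below h q with m≤n⇒m<n∨m≡n h
    ... | inj₁ lt = ≤-pred lt , q
    ... | inj₂ eq = contradiction (subst P eq q) ¬p

entry-map-applyUpTo : ∀ (f : ℕ → ℕ) g {n i} → i < n → entry (map f (applyUpTo g n)) (suc i) ≡ f (g i)
entry-map-applyUpTo f g {suc n} {zero}  _         = refl
entry-map-applyUpTo f g {suc n} {suc i} (s≤s i<n) = entry-map-applyUpTo f (λ x → g (suc x)) i<n

entry-map-applyUpTo-beyond : ∀ (f : ℕ → ℕ) g {n i} → n ≤ i → entry (map f (applyUpTo g n)) (suc i) ≡ 0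
entry-map-applyUpTo-beyond f g {zero}              _         = refl
entry-map-applyUpTo-beyond f g {suc n} {suc i} (s≤s n≤i) = entry-map-applyUpTo-beyond f (λ x → g (suc x)) n≤i

entryℤ-map-applyUpTo : ∀ (f : ℕ → ℤ) g {n i} → i < n → entryℤ (map f (applyUpTo g n)) (suc i) ≡ f (g i)
entryℤ-map-applyUpTo f g {suc n} {zero}  _         = refl
entryℤ-map-applyUpTo f g {suc n} {suc i} (s≤s i<n) = entryℤ-map-applyUpTo f (λ x → g (suc x)) i<n

entryℤ-map-applyUpTo-beyond : ∀ (f : ℕ → ℤ) g {n i} → n ≤ i → entryℤ (map f (applyUpTo g n)) (suc i) ≡ + 0
entryℤ-map-applyUpTo-beyond f g {zero}              _         = refl
entryℤ-map-applyUpTo-beyond f g {suc n} {suc i} (s≤s n≤i) = entryℤ-map-applyUpTo-beyond f (λ x → g (suc x)) n≤i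

entryℤ-map-+ : ∀ p i → entryℤ (map +_ p) i ≡ + entry p i
entryℤ-map-+ []      i             = refl
entryℤ-map-+ (x ∷ p) zero          = refl
entryℤ-map-+ (x ∷ p) (suc zero)    = refl
entryℤ-map-+ (x ∷ p) (suc (suc i)) = entryℤ-map-+ p (suc i)

entry-beyond-length : ∀ p {j} → length p < j → entry p j ≡ 0
entry-beyond-length []      _                 = refl
entry-beyond-length (x ∷ p) {suc (suc j)} (s≤s lt) = entry-beyond-length p lt

map-range-≈ : ∀ {f g : ℕ → ℤ} {m n} → n ≤ m →
              (∀ i → 1 ≤ i → i ≤ n → f i ≡ g i) → (∀ i → n < i → i ≤ m → f i ≡ + 0) →
              map f (range m) ≈ map g (range n)
map-range-≈ {f} {g} {m} {n} n≤m agree vanish (suc i) _ with suc i ≤? n | suc i ≤? m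
... | yes i<n | _ = begin
  entryℤ (map f (range m)) (suc i) ≡⟨ entryℤ-map-applyUpTo f suc (≤-trans i<n n≤m) ⟩
  f (suc i)                        ≡⟨ agree (suc i) (s≤s z≤n) i<n ⟩
  g (suc i)                        ≡⟨ entryℤ-map-applyUpTo g suc i<n ⟨
  entryℤ (map g (range n)) (suc i) ∎
  where open ≡-Reasoning
... | no i≮n | yes i<m = begin
  entryℤ (map f (range m)) (suc i) ≡⟨ entryℤ-map-applyUpTo f suc i<m ⟩
  f (suc i)                        ≡⟨ vanish (suc i) (≰⇒> i≮n) i<m ⟩
  + 0                              ≡⟨ entryℤ-map-applyUpTo-beyond g suc (≮⇒≥ i≮n) ⟨
  entryℤ (map g (range n)) (suc i) ∎
  where open ≡-Reasoning
... | no i≮n | no i≮m = trans (entryℤ-map-applyUpTo-beyond f suc (≮⇒≥ i≮m))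
                              (sym (entryℤ-map-applyUpTo-beyond g suc (≮⇒≥ i≮n)))

entry-antitone : ∀ {p} → IsPartition p → ∀ {i j} → 1 ≤ i → i ≤ j → entry p j ≤ entry p i
entry-antitone {p} p-part {suc i} {j} _ i<j =
  subst (λ x → entry p x ≤ entry p (suc i)) (trans (sym (+-suc _ i)) (m∸n+n≡m i<j)) (go (j ∸ suc i))
  where
    go : ∀ d → entry p (suc (d + i)) ≤ entry p (suc i)
    go zero    = ≤-refl
    go (suc d) = ≤-trans (p-part (d + i)) (go d)

nonzero-entry⇒≤ : ∀ {n p j} → PartsAtMost n p → 0 < entry p j → j ≤ n
nonzero-entry⇒≤ {j = j} p-parts pos =
  ≮⇒≥ (λ n<j → n≮0 (subst (0 <_) (p-parts j n<j) pos))

antitone⇒isPartition : ∀ {f : ℕ → ℕ} n → (∀ m → f (suc m) ≤ f m) → IsPartition (map f (range n))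
antitone⇒isPartition {f} n anti i with suc i <? n
... | yes i+1<n = subst₂ _≤_ (sym (entry-map-applyUpTo f suc i+1<n))
                             (sym (entry-map-applyUpTo f suc (<⇒≤ i+1<n)))
                             (anti (suc i))
... | no  i+1≮n = subst (_≤ entry (map f (range n)) (suc i))
                        (sym (entry-map-applyUpTo-beyond f suc (≮⇒≥ i+1≮n)))
                        z≤n

map-range-partsAtMost : ∀ (f : ℕ → ℕ) n → PartsAtMost n (map f (range n))
map-range-partsAtMost f n (suc i) (s≤s n≤i) = entry-map-applyUpTo-beyond f suc n≤i

entry-conj : ∀ {N p} → IsPartition p → PartsAtMost N p → ∀ i →
             entry (conj p) (suc i) ≡ count N (λ j → does (suc i ≤? entry p j))
entry-conj {N} {p} p-part p-parts i with i <? entry p 1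
... | yes i<p₁ = begin
  entry (conj p) (suc i)  ≡⟨ entry-map-applyUpTo (λ s → count (length p) (λ j → does (s ≤? entry p j))) suc i<p₁ ⟩
  count (length p) F      ≡⟨ count-pad (length p) N {P?} (λ j lt → unreached (entry-beyond-length p lt)) ⟨
  count (length p + N) F  ≡⟨ cong (λ x → count x F) (+-comm (length p) N) ⟩
  count (N + length p) F  ≡⟨ count-pad N (length p) {P?} (λ j lt → unreached (p-parts j lt)) ⟩
  count N F               ∎
  where
    open ≡-Reasoning
    P? = λ j → suc i ≤? entry p j
    F = λ j → does (P? j)
    unreached : ∀ {j} → entry p j ≡ 0 → ¬ suc i ≤ entry p j
    unreached pⱼ≡0 h = n≮0 (subst (suc i ≤_) pⱼ≡0 h)
... | no  i≮p₁ = trans (entry-map-applyUpTo-beyond _ suc (≮⇒≥ i≮p₁))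
                       (sym (count-none N {λ j → suc i ≤? entry p j}
                         (λ j 1≤j _ h → i≮p₁ (≤-trans h (entry-antitone {p} p-part ≤-refl 1≤j)))))

-≤-⇔ : ∀ a b c d → (+ a ℤ.- + b ℤ.≤ + c ℤ.- + d) ⇔ (a + d ≤ c + b)
-≤-⇔ a b c d = mk⇔
  (λ h → ℤₚ.drop‿+≤+ (subst₂ ℤ._≤_ (diff-+ (+ a) (+ b) (+ d)) (diff-+′ (+ c) (+ d) (+ b))
                                    (ℤₚ.+-monoˡ-≤ k h)))
  (λ h → subst₂ ℤ._≤_ (+-undo _ k) (+-undo _ k)
           (ℤₚ.+-monoˡ-≤ (ℤ.- k) (subst₂ ℤ._≤_ (sym (diff-+ (+ a) (+ b) (+ d)))
                                             (sym (diff-+′ (+ c) (+ d) (+ b))) (+≤+ h))))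
  where
    k = + b ℤ.+ + d
    diff-+ : ∀ x y w → (x ℤ.- y) ℤ.+ (y ℤ.+ w) ≡ x ℤ.+ w
    diff-+ = solve-∀
    diff-+′ : ∀ z w y → (z ℤ.- w) ℤ.+ (y ℤ.+ w) ≡ z ℤ.+ y
    diff-+′ = solve-∀
    +-undo : ∀ x k → x ℤ.+ k ℤ.- k ≡ x
    +-undo = solve-∀

-<-⇔ : ∀ a b c d → (+ a ℤ.- + b ℤ.< + c ℤ.- + d) ⇔ (a + d < c + b)
-<-⇔ a b c d = mk⇔
  (λ h → ≰⇒> (λ le → ℤₚ.<⇒≱ h (from (-≤-⇔ c d a b) le)))
  (λ h → ℤₚ.≰⇒> (λ le → <⇒≱ h (to (-≤-⇔ c d a b) le)))

v-[i-1]≥1⇔i≤v : ∀ v i → (+ v ℤ.- (+ i ℤ.- + 1) ℤ.≥ + 1) ⇔ (i ≤ v)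
v-[i-1]≥1⇔i≤v v i = mk⇔
  (λ h → subst (i ≤_) (+-identityʳ v) (≤-pred (to (-≤-⇔ 1 0 (suc v) i) (subst (+ 1 ℤ.≤_) shift h))))
  (λ h → subst (+ 1 ℤ.≤_) (sym shift)
                (from (-≤-⇔ 1 0 (suc v) i) (s≤s (subst (i ≤_) (sym (+-identityʳ v)) h))))
  where
    e : ∀ x y → x ℤ.- (y ℤ.- + 1) ≡ (+ 1 ℤ.+ x) ℤ.- y
    e = solve-∀
    shift : + v ℤ.- (+ i ℤ.- + 1) ≡ + suc v ℤ.- + i
    shift = e (+ v) (+ i)

maxIndex≤n : ∀ {n ν k} → PartsAtMost n ν → IsMaxIndex ν k → k ≤ n
maxIndex≤n ν-parts (inj₁ refl , _)          = z≤n
maxIndex≤n {ν = ν} ν-parts (inj₂ (1≤k , k-cond) , _) =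
  nonzero-entry⇒≤ {p = ν} ν-parts (≤-trans 1≤k (to (v-[i-1]≥1⇔i≤v _ _) k-cond))

maxIndex-≤⇔ : ∀ {ν k} → IsPartition ν → IsMaxIndex ν k → ∀ {i} → 1 ≤ i → (i ≤ k) ⇔ (i ≤ entry ν i)
maxIndex-≤⇔ {ν} {k} ν-part (k-cond , k-max) {i} 1≤i = mk⇔ (below k-cond) above
  where
    below : k ≡ 0 ⊎ (1 ≤ k × + entry ν k ℤ.- (+ k ℤ.- + 1) ℤ.≥ + 1) → i ≤ k → i ≤ entry ν i
    below (inj₁ k≡0)       i≤k = contradiction (≤-trans 1≤i (subst (i ≤_) k≡0 i≤k)) λ ()
    below (inj₂ (_ , k≤νₖ)) i≤k =
      ≤-trans i≤k (≤-trans (to (v-[i-1]≥1⇔i≤v _ _) k≤νₖ) (entry-antitone {ν} ν-part 1≤i i≤k))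
    above : i ≤ entry ν i → i ≤ k
    above i≤νᵢ = ≮⇒≥ (λ k<i → k-max i 1≤i k<i (from (v-[i-1]≥1⇔i≤v _ _) i≤νᵢ))

-- With μ = ∅ every μ_k is 0, and rho n [] ν, lam n [] ν are definitionally
-- map (λ j → ρ-entry n (entry ν j) j) (range n) and map (λ-entry n ν) (range n).
ρ-entry : ℕ → ℕ → ℕ → ℤ
ρ-entry n v j =
  (+ v ℤ.- + j) ℤ.+ + 1 ℤ.+ + count n (λ m → does ((+ v ℤ.- + j) ℤ.<? (+ 0 ℤ.- + m)))

λ-entry : ℕ → List ℕ → ℕ → ℤ
λ-entry n ν m = (+ 0 ℤ.- + m) ℤ.+ + count n (λ j → does ((+ 0 ℤ.- + m) ℤ.≤? (+ entry ν j ℤ.- + j)))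

ρ-entry-≤ : ∀ {n v j} → j ≤ v → ρ-entry n v j ≡ + v ℤ.- (+ j ℤ.- + 1)
ρ-entry-≤ {n} {v} {j} j≤v = begin
  (+ v ℤ.- + j) ℤ.+ + 1 ℤ.+ + count n (λ m → does (below? m))
    ≡⟨ cong (λ c → (+ v ℤ.- + j) ℤ.+ + 1 ℤ.+ + c)
            (count-none n {below?} (λ m _ _ h → <⇒≱ (to (-<-⇔ v j 0 m) h) (≤-trans j≤v (m≤m+n v m)))) ⟩
  (+ v ℤ.- + j) ℤ.+ + 1 ℤ.+ + 0
    ≡⟨ e (+ v) (+ j) ⟩
  + v ℤ.- (+ j ℤ.- + 1) ∎
  where
    open ≡-Reasoning
    below? = λ m → (+ v ℤ.- + j) ℤ.<? (+ 0 ℤ.- + m)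
    e : ∀ x y → (x ℤ.- y) ℤ.+ + 1 ℤ.+ + 0 ≡ x ℤ.- (y ℤ.- + 1)
    e = solve-∀

ρ-entry-> : ∀ {n v j} → j ≤ n → v < j → ρ-entry n v j ≡ + 0
ρ-entry-> {n} {v} {j} j≤n v<j with j ∸ suc v | m+[n∸m]≡n v<j
... | c | refl = begin
  (+ v ℤ.- + suc (v + c)) ℤ.+ + 1 ℤ.+ + count n (λ m → does (below? m))
    ≡⟨ cong (λ x → (+ v ℤ.- + suc (v + c)) ℤ.+ + 1 ℤ.+ + x)
            (trans (count-⇔ n {below?} {_≤? c} (λ m _ _ → below⇔ m))
                   (count-≤? (≤-trans (m≤n+m c (suc v)) j≤n))) ⟩
  (+ v ℤ.- + suc (v + c)) ℤ.+ + 1 ℤ.+ + c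
    ≡⟨ e (+ v) (+ c) ⟩
  + 0 ∎
  where
    open ≡-Reasoning
    below? = λ m → (+ v ℤ.- + suc (v + c)) ℤ.<? (+ 0 ℤ.- + m)
    below⇔ : ∀ m → (+ v ℤ.- + suc (v + c) ℤ.< + 0 ℤ.- + m) ⇔ (m ≤ c)
    below⇔ m = mk⇔ (λ h → +-cancelˡ-≤ v m c (≤-pred (to (-<-⇔ v (suc (v + c)) 0 m) h)))
                   (λ h → from (-<-⇔ v (suc (v + c)) 0 m) (s≤s (+-monoʳ-≤ v h)))
    e : ∀ x y → (x ℤ.- (+ 1 ℤ.+ (x ℤ.+ y))) ℤ.+ + 1 ℤ.+ y ≡ + 0
    e = solve-∀

rho∅≈rhoTarget : ∀ {n ν k} → IsPartition ν → PartsAtMost n ν → IsMaxIndex ν k →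
                 rho n [] ν ≈ rhoTarget ν k
rho∅≈rhoTarget {n} {ν} {k} ν-part ν-parts k-max =
  map-range-≈ {f = λ j → ρ-entry n (entry ν j) j} (maxIndex≤n {ν = ν} ν-parts k-max) agree vanish
  where
    agree : ∀ i → 1 ≤ i → i ≤ k → ρ-entry n (entry ν i) i ≡ + entry ν i ℤ.- (+ i ℤ.- + 1)
    agree i 1≤i i≤k = ρ-entry-≤ {n} (to (maxIndex-≤⇔ {ν} ν-part k-max 1≤i) i≤k)
    vanish : ∀ i → k < i → i ≤ n → ρ-entry n (entry ν i) i ≡ + 0
    vanish i k<i i≤n = ρ-entry-> i≤n
      (≰⇒> (λ i≤νᵢ → <⇒≱ k<i (from (maxIndex-≤⇔ {ν} ν-part k-max (≤-trans (s≤s z≤n) k<i)) i≤νᵢ)))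

-- The truncated subtraction is exact for m ≤ n (see λ-entry≡lamPart).
lamPart : ℕ → List ℕ → ℕ → ℕ
lamPart n ν m = count n (λ j → does (j ≤? entry ν j + m)) ∸ m

lamPartition : ℕ → List ℕ → List ℕ
lamPartition n ν = map (lamPart n ν) (range n)

suc≤∸⇔ : ∀ a b c → (suc a ≤ c ∸ b) ⇔ (suc a + b ≤ c)
suc≤∸⇔ a b c = mk⇔ (λ h → m≤o∸n⇒m+n≤o (suc a) (b≤c h) h) (m+n≤o⇒m≤o∸n (suc a))
  where
    b≤c : suc a ≤ c ∸ b → b ≤ c
    b≤c h = ≮⇒≥ (λ c<b → n≮0 (subst (suc a ≤_) (m≤n⇒m∸n≡0 (<⇒≤ c<b)) h))

module _ {n ν} (ν-part : IsPartition ν) (ν-parts : PartsAtMost n ν) where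

  private
    within? : ∀ m → Decidable (λ j → j ≤ entry ν j + m)
    within? m j = j ≤? entry ν j + m

    within-closed : ∀ m j → suc j ≤ entry ν (suc j) + m → j ≤ entry ν j + m
    within-closed m zero    _ = z≤n
    within-closed m (suc j) h = ≤-trans (n≤1+n _) (≤-trans h (+-monoˡ-≤ m (ν-part j)))

  longRowsBelow : ℕ → ℕ
  longRowsBelow i = count n (λ m → does (i ≤? entry ν (i + m)))

  ≤lamPart⇔ : ∀ m i → (suc i ≤ lamPart n ν m) ⇔ (suc i ≤ entry ν (suc i + m))
  ≤lamPart⇔ m i = mk⇔
    (λ h → +-cancelʳ-≤ m (suc i) _ (proj₂ (to counted (to (suc≤∸⇔ i m _) h))))
    (λ h → from (suc≤∸⇔ i m _) (from counted
      (nonzero-entry⇒≤ {p = ν} ν-parts (≤-trans (s≤s z≤n) h) , +-monoˡ-≤ m h)))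
    where
      counted : (suc (i + m) ≤ count n (λ j → does (within? m j)))
                ⇔ (suc (i + m) ≤ n × suc (i + m) ≤ entry ν (suc (i + m)) + m)
      counted = count-downwardClosed n {within? m} (within-closed m) (i + m)

  lamPart-antitone : ∀ m → lamPart n ν (suc m) ≤ lamPart n ν m
  lamPart-antitone m with lamPart n ν (suc m) in eq
  ... | zero  = z≤n
  ... | suc i = from (≤lamPart⇔ m i)
                  (≤-trans (to (≤lamPart⇔ (suc m) i) (≤-reflexive (sym eq)))
                           (entry-antitone {ν} ν-part (s≤s z≤n) (+-monoʳ-≤ (suc i) (n≤1+n m))))

  λ-entry≡lamPart : ∀ {m} → m ≤ n → λ-entry n ν m ≡ + lamPart n ν m
  λ-entry≡lamPart {m} m≤n = begin
    (+ 0 ℤ.- + m) ℤ.+ + count n (λ j → does (above? j))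
      ≡⟨ cong (λ c → (+ 0 ℤ.- + m) ℤ.+ + c)
              (count-⇔ n {above?} {within? m} (λ j _ _ → -≤-⇔ 0 m (entry ν j) j)) ⟩
    (+ 0 ℤ.- + m) ℤ.+ + c   ≡⟨ e (+ m) (+ c) ⟩
    + c ℤ.- + m             ≡⟨ ℤₚ.[+m]-[+n]≡m⊖n c m ⟩
    c ℤ.⊖ m                 ≡⟨ ℤₚ.⊖-≥ (m≤count m≤n) ⟩
    + (c ∸ m)               ∎
    where
      open ≡-Reasoning
      above? = λ j → (+ 0 ℤ.- + m) ℤ.≤? (+ entry ν j ℤ.- + j)
      c = count n (λ j → does (within? m j))
      e : ∀ x y → (+ 0 ℤ.- x) ℤ.+ y ≡ y ℤ.- x
      e = solve-∀
      m≤count : ∀ {l} → l ≤ n → l ≤ count n (λ j → does (within? l j))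
      m≤count {zero}  _   = z≤n
      m≤count {suc t} l≤n =
        from (count-downwardClosed n {within? (suc t)} (within-closed (suc t)) t) (l≤n , m≤n+m _ _)

  lam∅≈lamPartition : lam n [] ν ≈ map +_ (lamPartition n ν)
  lam∅≈lamPartition =
    subst (lam n [] ν ≈_) (map-∘ (range n))
      (map-range-≈ {f = λ-entry n ν} ≤-refl (λ m _ m≤n → λ-entry≡lamPart m≤n)
                   (λ i n<i i≤n → contradiction i≤n (<⇒≱ n<i)))

  lamPartition-isPartition : IsPartition (lamPartition n ν)
  lamPartition-isPartition = antitone⇒isPartition n lamPart-antitone

  entry-conj-lamPartition : ∀ i → entry (conj (lamPartition n ν)) (suc i) ≡ longRowsBelow (suc i)
  entry-conj-lamPartition i =
    trans (entry-conj {n} {lamPartition n ν} lamPartition-isPartition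
                      (map-range-partsAtMost (lamPart n ν) n) i)
          (count-⇔ n {λ m → suc i ≤? entry (lamPartition n ν) m}
                     {λ m → suc i ≤? entry ν (suc i + m)} part⇔)
    where
      part⇔ : ∀ m → 1 ≤ m → m ≤ n → (suc i ≤ entry (lamPartition n ν) m) ⇔ (suc i ≤ entry ν (suc i + m))
      part⇔ (suc m) _ m<n rewrite entry-map-applyUpTo (lamPart n ν) suc m<n = ≤lamPart⇔ (suc m) i

  entry-conj-split : ∀ i → suc i ≤ entry ν (suc i) → entry (conj ν) (suc i) ≡ suc i + longRowsBelow (suc i)
  entry-conj-split i i<νᵢ = begin
    entry (conj ν) (suc i)                             ≡⟨ entry-conj {n} {ν} ν-part ν-parts i ⟩
    count n (λ j → does (P? j))                        ≡⟨ count-split {P? = P?} i<n vanish ⟩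
    count (suc i) (λ j → does (P? j)) + count n shifted
      ≡⟨ cong (_+ count n shifted) (count-all (suc i) {P?} prefix) ⟩
    suc i + count n shifted                            ∎
    where
      open ≡-Reasoning
      P? = λ j → suc i ≤? entry ν j
      shifted = λ m → does (P? (suc i + m))
      i<n : suc i ≤ n
      i<n = nonzero-entry⇒≤ {p = ν} ν-parts (≤-trans (s≤s z≤n) i<νᵢ)
      vanish : ∀ j → n < j → ¬ suc i ≤ entry ν j
      vanish j n<j h = n≮0 (subst (suc i ≤_) (ν-parts j n<j) h)
      prefix : ∀ j → 1 ≤ j → j ≤ suc i → suc i ≤ entry ν j
      prefix j 1≤j j≤i = ≤-trans i<νᵢ (entry-antitone {ν} ν-part 1≤j j≤i)

  conj-lamPartition≈ : ∀ {k} → IsMaxIndex ν k → map +_ (conj (lamPartition n ν)) ≈ lamConjTarget ν k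
  conj-lamPartition≈ {k} k-max (suc i) _ with suc i ≤? entry ν (suc i)
  ... | yes i<νᵢ = begin
    entryℤ (map +_ (conj (lamPartition n ν))) (suc i) ≡⟨ entryℤ-map-+ (conj (lamPartition n ν)) (suc i) ⟩
    + entry (conj (lamPartition n ν)) (suc i)         ≡⟨ cong +_ (entry-conj-lamPartition i) ⟩
    + longRowsBelow (suc i)                          ≡⟨ e (+ suc i) (+ longRowsBelow (suc i)) ⟨
    + (suc i + longRowsBelow (suc i)) ℤ.- + suc i    ≡⟨ cong (λ x → + x ℤ.- + suc i) (entry-conj-split i i<νᵢ) ⟨
    + entry (conj ν) (suc i) ℤ.- + suc i             ≡⟨ entryℤ-map-applyUpTo _ suc i<k ⟨
    entryℤ (lamConjTarget ν k) (suc i)               ∎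
    where
      open ≡-Reasoning
      e : ∀ x y → (x ℤ.+ y) ℤ.- x ≡ y
      e = solve-∀
      i<k : i < k
      i<k = from (maxIndex-≤⇔ {ν} ν-part k-max (s≤s z≤n)) i<νᵢ
  ... | no  i≮νᵢ = begin
    entryℤ (map +_ (conj (lamPartition n ν))) (suc i) ≡⟨ entryℤ-map-+ (conj (lamPartition n ν)) (suc i) ⟩
    + entry (conj (lamPartition n ν)) (suc i)         ≡⟨ cong +_ (entry-conj-lamPartition i) ⟩
    + longRowsBelow (suc i)
      ≡⟨ cong +_ (count-none n {λ m → suc i ≤? entry ν (suc i + m)} none) ⟩
    + 0                                              ≡⟨ entryℤ-map-applyUpTo-beyond _ suc k≤i ⟨
    entryℤ (lamConjTarget ν k) (suc i)               ∎
    where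
      open ≡-Reasoning
      none : ∀ m → 1 ≤ m → m ≤ n → ¬ suc i ≤ entry ν (suc i + m)
      none m _ _ h = i≮νᵢ (≤-trans h (entry-antitone {ν} ν-part (s≤s z≤n) (m≤m+n (suc i) m)))
      k≤i : k ≤ i
      k≤i = ≮⇒≥ (λ i<k → i≮νᵢ (to (maxIndex-≤⇔ {ν} ν-part k-max (s≤s z≤n)) i<k))

lemma2p3 : (n : ℕ) (ν : List ℕ) → IsPartition ν → PartsAtMost n ν →
    (k : ℕ) → IsMaxIndex ν k →
    (rho n [] ν ≈ rhoTarget ν k) ×
    (∃[ L ] (IsPartition L × (lam n [] ν ≈ map +_ L) × (map +_ (conj L) ≈ lamConjTarget ν k)))
lemma2p3 n ν ν-part ν-parts k k-max =
  rho∅≈rhoTarget {n} {ν} ν-part ν-parts k-max ,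
  ( lamPartition n ν
  , lamPartition-isPartition {n} {ν} ν-part ν-parts
  , lam∅≈lamPartition {n} {ν} ν-part ν-parts
  , conj-lamPartition≈ {n} {ν} ν-part ν-parts k-max )
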